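{- Let $G=(V,E)$ be a finite simple undirected graph with $n=|V|$ vertices, $m=|E|$ edges and degeneracy $d$. Let $G_{VCC}=(V_{VCC},E_{VCC})$ be the graph with one vertex $v_{xy}$ for each edge $\{x,y\}\in E$, in which two distinct vertices $v_{xy}$ and $v_{wz}$ are adjacent if and only if there is a clique of $G$ containing both edges $\{x,y\}$ and $\{w,z\}$ (i.e. $\{x,y\}\cup\{w,z\}$ is a clique of $G$). Then $|V_{VCC}| = m \leq dn$ and $|E_{VCC}| = O(d^2 m)$.
   Context: The degeneracy $d$ of a graph $G$ is the smallest value such that every nonempty subgraph of $G$ has a vertex of degree at most $d$. A clique is a set of pairwise adjacent vertices. The $O(\cdot)$ bound is with respect to the parameters $d$ and $m$, with an absolute constant. -}

module Defs where

open import Data.Bool using (Bool; true; false; _∧_; _∨_; if_then_else_)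
open import Data.Nat using (ℕ; _≤_; _<ᵇ_; _≡ᵇ_)
open import Data.Fin using (Fin; toℕ)
open import Data.List using (List; length; filterᵇ; map; allFin)
open import Data.Nat.ListAction using (sum)
open import Data.Vec using (lookup)
open import Data.Fin.Subset using (Subset; _∈_)
open import Data.Product using (Σ; ∃; _×_)
open import Relation.Binary.PropositionalEquality using (_≡_)

record Graph (n : ℕ) : Set where
  field
    adj   : Fin n → Fin n → Bool
    sym   : ∀ i j → adj i j ≡ adj j i
    irrefl : ∀ i → adj i i ≡ false
open Graph public

count : ∀ {n} → (Fin n → Bool) → ℕ
count {n} p = length (filterᵇ p (allFin n))

_<v_ : ∀ {n} → Fin n → Fin n → Bool
i <v j = toℕ i <ᵇ toℕ j

_=v_ : ∀ {n} → Fin n → Fin n → Bool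
i =v j = toℕ i ≡ᵇ toℕ j

numEdges : ∀ {n} → Graph n → ℕ
numEdges {n} G = sum (map (λ x → count (λ y → (x <v y) ∧ adj G x y)) (allFin n))

-- vertices of G_VCC are the edges of G, so |V_VCC| = numEdges G
numVCCVertices : ∀ {n} → Graph n → ℕ
numVCCVertices = numEdges

eqOrAdj : ∀ {n} → Graph n → Fin n → Fin n → Bool
eqOrAdj G x y = (x =v y) ∨ adj G x y

-- {x,y} ∪ {w,z} is a clique of G, given that {x,y} and {w,z} are edges
unionClique : ∀ {n} → Graph n → Fin n → Fin n → Fin n → Fin n → Bool
unionClique G x y w z =
  eqOrAdj G x w ∧ eqOrAdj G x z ∧ eqOrAdj G y w ∧ eqOrAdj G y z

isEdge : ∀ {n} → Graph n → Fin n → Fin n → Bool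
isEdge G x y = (x <v y) ∧ adj G x y

lexLt : ∀ {n} → Fin n → Fin n → Fin n → Fin n → Bool
lexLt x y w z = (x <v w) ∨ ((x =v w) ∧ (y <v z))

-- number of edges of G_VCC: unordered pairs of distinct edges {x,y} , {w,z}
-- of G (counted once via the lexicographic order) whose union is a clique
numVCCEdges : ∀ {n} → Graph n → ℕ
numVCCEdges {n} G =
  sum (map (λ x → sum (map (λ y → sum (map (λ w → count (λ z →
    isEdge G x y ∧ isEdge G w z ∧ lexLt x y w z ∧ unionClique G x y w z))
    (allFin n))) (allFin n))) (allFin n))

degIn : ∀ {n} → Graph n → Subset n → Fin n → ℕ
degIn G S v = count (λ u → lookup S u ∧ adj G v u)

DegenerateBy : ∀ {n} → Graph n → ℕ → Set
DegenerateBy {n} G d =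
  (S : Subset n) → (∃ λ v → v ∈ S) → ∃ λ v → v ∈ S × degIn G S v ≤ d

IsDegeneracy : ∀ {n} → Graph n → ℕ → Set
IsDegeneracy G d = DegenerateBy G d × (∀ d' → DegenerateBy G d' → d ≤ d')

{-# OPTIONS --safe #-}
module Submission where

-- Peel G vertex by vertex, always deleting a vertex v of degree δ ≤ d in the current induced
-- subgraph G[S], as d-degeneracy allows. Deleting v removes 2δ ordered adjacent pairs. It also
-- removes the ordered pairs of edges (x,y), (w,z) of G[S] spanning a clique that involve v:
-- v sits at one of four positions, its partner in that edge is one of its δ neighbours and the
-- two vertices of the other edge lie in its closed neighbourhood, so at most 4δ(δ+1)² ≤ 16d²δ
-- of them disappear. Summing over the peeling order gives 2m ≤ 2dn, and the number of such
-- pairs, which over-counts the edges of G_VCC, is at most 8d² · 2m.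

open import Defs
open import Data.Nat using (ℕ; _≤_; _*_)
open import Data.Product using (∃; _×_)
open import Relation.Binary.PropositionalEquality using (_≡_)

open import Algebra.Properties.CommutativeSemigroup using (interchange)
open import Data.Bool using (Bool; true; false; T; _∧_; _∨_)
open import Data.Bool.Properties using (T-∧; T-∨; T-≡; ¬-not)
open import Data.Empty using (⊥-elim)
open import Data.Fin using (Fin; zero; suc; toℕ)
open import Data.Fin.Properties using (toℕ-injective)
open import Data.Fin.Subset using (Subset; inside; outside; _∈_; ⊤) renaming (⊥ to ∅)
open import Data.Fin.Subset.Properties using (Empty-unique; nonempty?)
open import Data.List using ([]; _∷_; length; filterᵇ; map; allFin; tabulate)
open import Data.List.Properties using (map-tabulate)
open import Data.Nat using (zero; suc; _+_; z≤n; s≤s; _<_)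
open import Data.Nat.Induction using (<-wellFounded)
open import Data.Nat.ListAction using (sum)
open import Data.Nat.Properties
open import Data.Nat.Tactic.RingSolver using (solve-∀)
open import Data.Product using (_,_; proj₁; proj₂)
import Data.Sum as Sum
open import Data.Vec using ([]; _∷_; lookup; here; there; _[_]≔_)
open import Function using (_∘_; _on_; Equivalence)
open import Induction.WellFounded using (Acc; acc)
open import Relation.Binary using (tri<; tri≈; tri>)
import Relation.Binary.Construct.On as On
open import Relation.Binary.PropositionalEquality as ≡
  using (refl; cong; cong₂; subst; trans; module ≡-Reasoning)
open import Relation.Nullary using (¬_; yes; no)

private
  variable
    m n : ℕ

𝟙 : Bool → ℕ
𝟙 true  = 1
𝟙 false = 0

𝟙-mono : ∀ {a b} → (T a → T b) → 𝟙 a ≤ 𝟙 b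
𝟙-mono {false}         _ = z≤n
𝟙-mono {true}  {true}  _ = ≤-refl
𝟙-mono {true}  {false} h = ⊥-elim (h _)

𝟙-∨-≤ : ∀ a b → 𝟙 (a ∨ b) ≤ 𝟙 a + 𝟙 b
𝟙-∨-≤ true  _ = s≤s z≤n
𝟙-∨-≤ false _ = ≤-refl

𝟙-≤-* : ∀ {a} b c e → (T a → T b × T c × T e) → 𝟙 a ≤ 𝟙 b * (𝟙 c * 𝟙 e)
𝟙-≤-* {false} _     _     _     _ = z≤n
𝟙-≤-* {true}  true  true  true  _ = ≤-refl
𝟙-≤-* {true}  false _     _     h = ⊥-elim (proj₁ (h _))
𝟙-≤-* {true}  true  false _     h = ⊥-elim (proj₁ (proj₂ (h _)))
𝟙-≤-* {true}  true  true  false h = ⊥-elim (proj₂ (proj₂ (h _)))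

∑ : Subset n → (Fin n → ℕ) → ℕ
∑ []            f = 0
∑ (inside  ∷ S) f = f zero + ∑ S (f ∘ suc)
∑ (outside ∷ S) f = ∑ S (f ∘ suc)

infixl 10 ∑
syntax ∑ S (λ x → e) = ∑[ x ∈ S ] e

∑² : Subset n → (Fin n → Fin n → ℕ) → ℕ
∑² S g = ∑[ x ∈ S ] ∑[ y ∈ S ] g x y

∑-cong : ∀ (S : Subset n) {f g : Fin n → ℕ} → (∀ x → f x ≡ g x) → ∑ S f ≡ ∑ S g
∑-cong []            eq = refl
∑-cong (inside  ∷ S) eq = cong₂ _+_ (eq zero) (∑-cong S (eq ∘ suc))
∑-cong (outside ∷ S) eq = ∑-cong S (eq ∘ suc)

∑-mono : ∀ (S : Subset n) {f g : Fin n → ℕ} → (∀ x → f x ≤ g x) → ∑ S f ≤ ∑ S g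
∑-mono []            le = z≤n
∑-mono (inside  ∷ S) le = +-mono-≤ (le zero) (∑-mono S (le ∘ suc))
∑-mono (outside ∷ S) le = ∑-mono S (le ∘ suc)

∑-zero : ∀ (S : Subset n) → ∑[ x ∈ S ] 0 ≡ 0
∑-zero []            = refl
∑-zero (inside  ∷ S) = ∑-zero S
∑-zero (outside ∷ S) = ∑-zero S

∑-distrib-+ : ∀ (S : Subset n) (f g : Fin n → ℕ) → ∑[ x ∈ S ] (f x + g x) ≡ ∑ S f + ∑ S g
∑-distrib-+ []            f g = refl
∑-distrib-+ (inside  ∷ S) f g = trans (cong (f zero + g zero +_) (∑-distrib-+ S (f ∘ suc) (g ∘ suc)))
  (interchange +-commutativeSemigroup (f zero) (g zero) _ _)
∑-distrib-+ (outside ∷ S) f g = ∑-distrib-+ S (f ∘ suc) (g ∘ suc)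

∑-*ˡ : ∀ (S : Subset n) c (f : Fin n → ℕ) → ∑[ x ∈ S ] (c * f x) ≡ c * ∑ S f
∑-*ˡ []            c f = ≡.sym (*-zeroʳ c)
∑-*ˡ (inside  ∷ S) c f = trans (cong (c * f zero +_) (∑-*ˡ S c (f ∘ suc))) (≡.sym (*-distribˡ-+ c _ _))
∑-*ˡ (outside ∷ S) c f = ∑-*ˡ S c (f ∘ suc)

∑-*ʳ : ∀ (S : Subset n) c (f : Fin n → ℕ) → ∑[ x ∈ S ] (f x * c) ≡ ∑ S f * c
∑-*ʳ S c f = trans (∑-cong S (λ x → *-comm (f x) c)) (trans (∑-*ˡ S c f) (*-comm c _))

∑-comm : ∀ (S : Subset n) (R : Subset m) (f : Fin n → Fin m → ℕ) →
         ∑[ x ∈ S ] ∑[ y ∈ R ] f x y ≡ ∑[ y ∈ R ] ∑[ x ∈ S ] f x y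
∑-comm []            R f = ≡.sym (∑-zero R)
∑-comm (inside  ∷ S) R f = trans (cong (∑ R (f zero) +_) (∑-comm S R (f ∘ suc)))
  (≡.sym (∑-distrib-+ R (f zero) _))
∑-comm (outside ∷ S) R f = ∑-comm S R (f ∘ suc)

∑-∅ : ∀ (f : Fin n → ℕ) → ∑ ∅ f ≡ 0
∑-∅ {zero}  f = refl
∑-∅ {suc n} f = ∑-∅ (f ∘ suc)

∑-≤-∑⊤ : ∀ (S : Subset n) (f : Fin n → ℕ) → ∑ S f ≤ ∑ ⊤ f
∑-≤-∑⊤ []            f = z≤n
∑-≤-∑⊤ (inside  ∷ S) f = +-monoʳ-≤ (f zero) (∑-≤-∑⊤ S (f ∘ suc))
∑-≤-∑⊤ (outside ∷ S) f = ≤-trans (∑-≤-∑⊤ S (f ∘ suc)) (m≤n+m _ (f zero))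

infixl 5 _-_

_-_ : Subset n → Fin n → Subset n
S - v = S [ v ]≔ outside

∑-remove : ∀ {S : Subset n} {v} (f : Fin n → ℕ) → v ∈ S → ∑ S f ≡ ∑ (S - v) f + f v
∑-remove {S = inside  ∷ S} f here = +-comm (f zero) _
∑-remove {S = inside  ∷ S} f (there v∈S) =
  trans (cong (f zero +_) (∑-remove (f ∘ suc) v∈S)) (≡.sym (+-assoc (f zero) _ _))
∑-remove {S = outside ∷ S} f (there v∈S) = ∑-remove (f ∘ suc) v∈S

∑-remove-≤ : ∀ {S : Subset n} {v} (f : Fin n → ℕ) → v ∈ S → ∑ (S - v) f ≤ ∑ S f
∑-remove-≤ f v∈S = ≤-trans (m≤m+n _ _) (≤-reflexive (≡.sym (∑-remove f v∈S)))

size : Subset n → ℕ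
size S = ∑[ x ∈ S ] 1

size-⊤ : ∀ n → size (⊤ {n}) ≡ n
size-⊤ zero    = refl
size-⊤ (suc n) = cong suc (size-⊤ n)

size-remove : ∀ {S : Subset n} {v} → v ∈ S → size S ≡ suc (size (S - v))
size-remove v∈S = trans (∑-remove (λ _ → 1) v∈S) (+-comm _ 1)

∑²-mono : ∀ (S : Subset n) {g h : Fin n → Fin n → ℕ} → (∀ x y → g x y ≤ h x y) → ∑² S g ≤ ∑² S h
∑²-mono S le = ∑-mono S (λ x → ∑-mono S (le x))

∑²-distrib-+ : ∀ (S : Subset n) (g h : Fin n → Fin n → ℕ) →
               ∑² S (λ x y → g x y + h x y) ≡ ∑² S g + ∑² S h
∑²-distrib-+ S g h = trans (∑-cong S (λ x → ∑-distrib-+ S (g x) (h x))) (∑-distrib-+ S _ _)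

∑²-remove : ∀ {S : Subset n} {v} (g : Fin n → Fin n → ℕ) → v ∈ S →
            ∑² S g ≡ ∑² (S - v) g + (∑[ x ∈ S - v ] g x v + ∑[ y ∈ S ] g v y)
∑²-remove {S = S} {v} g v∈S = begin
  ∑[ x ∈ S ] ∑[ y ∈ S ] g x y                                     ≡⟨ ∑-remove (λ x → ∑ S (g x)) v∈S ⟩
  ∑[ x ∈ S - v ] ∑[ y ∈ S ] g x y + ∑[ y ∈ S ] g v y              ≡⟨ cong (_+ ∑ S (g v)) (∑-cong (S - v) (λ x → ∑-remove (g x) v∈S)) ⟩
  ∑[ x ∈ S - v ] (∑[ y ∈ S - v ] g x y + g x v) + ∑[ y ∈ S ] g v y ≡⟨ cong (_+ ∑ S (g v)) (∑-distrib-+ (S - v) _ _) ⟩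
  ∑² (S - v) g + ∑[ x ∈ S - v ] g x v + ∑[ y ∈ S ] g v y           ≡⟨ +-assoc (∑² (S - v) g) _ _ ⟩
  ∑² (S - v) g + (∑[ x ∈ S - v ] g x v + ∑[ y ∈ S ] g v y)         ∎
  where open ≡-Reasoning

∑²-remove-≤ : ∀ {S : Subset n} {v} (g : Fin n → Fin n → ℕ) → v ∈ S → ∑² (S - v) g ≤ ∑² S g
∑²-remove-≤ {S = S} g v∈S =
  ≤-trans (∑-mono (S - _) (λ x → ∑-remove-≤ (g x) v∈S)) (∑-remove-≤ (λ x → ∑ S (g x)) v∈S)

∑⁴-remove-≤ : ∀ {S : Subset n} {v} (F : Fin n → Fin n → Fin n → Fin n → ℕ) → v ∈ S →
  ∑² S (λ x y → ∑² S (F x y)) ≤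
  ∑² (S - v) (λ x y → ∑² (S - v) (F x y)) +
    (∑² S (λ x y → ∑[ w ∈ S ] F x y w v + ∑[ z ∈ S ] F x y v z) +
      (∑[ x ∈ S ] ∑² S (F x v) + ∑[ y ∈ S ] ∑² S (F v y)))
∑⁴-remove-≤ {n} {S} {v} F v∈S = begin
  ∑² S H                                               ≡⟨ ∑²-remove H v∈S ⟩
  ∑² (S - v) H + (∑[ x ∈ S - v ] H x v + ∑ S (H v))   ≤⟨ +-mono-≤ (∑²-mono (S - v) H≤H′+R)
                                                            (+-monoˡ-≤ (∑ S (H v)) (∑-remove-≤ (λ x → H x v) v∈S)) ⟩
  ∑² (S - v) (λ x y → H′ x y + R x y) + C             ≡⟨ cong (_+ C) (∑²-distrib-+ (S - v) H′ R) ⟩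
  ∑² (S - v) H′ + ∑² (S - v) R + C                    ≤⟨ +-monoˡ-≤ C (+-monoʳ-≤ (∑² (S - v) H′) (∑²-remove-≤ R v∈S)) ⟩
  ∑² (S - v) H′ + ∑² S R + C                          ≡⟨ +-assoc (∑² (S - v) H′) _ _ ⟩
  ∑² (S - v) H′ + (∑² S R + C)                        ∎
  where
  open ≤-Reasoning
  H H′ R : Fin n → Fin n → ℕ
  H  x y = ∑² S (F x y)
  H′ x y = ∑² (S - v) (F x y)
  R  x y = ∑[ w ∈ S ] F x y w v + ∑[ z ∈ S ] F x y v z
  C : ℕ
  C = ∑[ x ∈ S ] H x v + ∑[ y ∈ S ] H v y
  H≤H′+R : ∀ x y → H x y ≤ H′ x y + R x y
  H≤H′+R x y = ≤-trans (≤-reflexive (∑²-remove (F x y) v∈S))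
    (+-monoʳ-≤ (H′ x y) (+-monoˡ-≤ (∑ S (F x y v)) (∑-remove-≤ (λ w → F x y w v) v∈S)))

∑³-≤-product : ∀ (S : Subset n) {F : Fin n → Fin n → Fin n → ℕ} (f g h : Fin n → ℕ) →
  (∀ a b c → F a b c ≤ f a * (g b * h c)) →
  ∑[ a ∈ S ] ∑[ b ∈ S ] ∑[ c ∈ S ] F a b c ≤ ∑ S f * (∑ S g * ∑ S h)
∑³-≤-product S f g h le = begin
  ∑[ a ∈ S ] ∑[ b ∈ S ] ∑[ c ∈ S ] _         ≤⟨ ∑-mono S (λ a → ∑-mono S (λ b → ∑-mono S (le a b))) ⟩
  ∑[ a ∈ S ] ∑[ b ∈ S ] ∑[ c ∈ S ] (f a * (g b * h c))
    ≡⟨ ∑-cong S (λ a → ∑-cong S (λ b → trans (∑-*ˡ S (f a) _) (cong (f a *_) (∑-*ˡ S (g b) h)))) ⟩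
  ∑[ a ∈ S ] ∑[ b ∈ S ] (f a * (g b * ∑ S h))
    ≡⟨ ∑-cong S (λ a → trans (∑-*ˡ S (f a) _) (cong (f a *_) (∑-*ʳ S (∑ S h) g))) ⟩
  ∑[ a ∈ S ] (f a * (∑ S g * ∑ S h))            ≡⟨ ∑-*ʳ S _ f ⟩
  ∑ S f * (∑ S g * ∑ S h)                     ∎
  where open ≤-Reasoning

∑⊤-=v : ∀ (v : Fin n) → ∑[ u ∈ ⊤ ] 𝟙 (v =v u) ≡ 1
∑⊤-=v {suc n} zero    = cong suc (∑-zero (⊤ {n}))
∑⊤-=v {suc n} (suc v) = ∑⊤-=v v

∑⊤-lookup-∧ : ∀ (S : Subset n) (p : Fin n → Bool) → ∑[ x ∈ ⊤ ] 𝟙 (lookup S x ∧ p x) ≡ ∑[ x ∈ S ] 𝟙 (p x)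
∑⊤-lookup-∧ []            p = refl
∑⊤-lookup-∧ (inside  ∷ S) p = cong (𝟙 (p zero) +_) (∑⊤-lookup-∧ S (p ∘ suc))
∑⊤-lookup-∧ (outside ∷ S) p = ∑⊤-lookup-∧ S (p ∘ suc)

sum-map-allFin : ∀ (f : Fin n → ℕ) → sum (map f (allFin n)) ≡ ∑ ⊤ f
sum-map-allFin {n} f = trans (cong sum (map-tabulate (λ x → x) f)) (sum-tabulate f)
  where
  sum-tabulate : ∀ {n} (f : Fin n → ℕ) → sum (tabulate f) ≡ ∑ ⊤ f
  sum-tabulate {zero}  f = refl
  sum-tabulate {suc n} f = cong (f zero +_) (sum-tabulate (f ∘ suc))

count≡∑⊤ : ∀ (p : Fin n → Bool) → count p ≡ ∑[ x ∈ ⊤ ] 𝟙 (p x)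
count≡∑⊤ {n} p = trans (length-filterᵇ (allFin n)) (sum-map-allFin (𝟙 ∘ p))
  where
  length-filterᵇ : ∀ xs → length (filterᵇ p xs) ≡ sum (map (𝟙 ∘ p) xs)
  length-filterᵇ []       = refl
  length-filterᵇ (x ∷ xs) with p x
  ... | true  = cong suc (length-filterᵇ xs)
  ... | false = length-filterᵇ xs

<v-true : ∀ {x y : Fin n} → toℕ x < toℕ y → (x <v y) ≡ true
<v-true x<y = Equivalence.to T-≡ (<⇒<ᵇ x<y)

<v-false : ∀ {x y : Fin n} → ¬ toℕ x < toℕ y → (x <v y) ≡ false
<v-false x≮y = ¬-not (λ e → x≮y (<ᵇ⇒< _ _ (Equivalence.from T-≡ e)))

=v-sym : ∀ {x y : Fin n} → T (x =v y) → T (y =v x)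
=v-sym {x = x} {y} t = ≡⇒≡ᵇ (toℕ y) (toℕ x) (≡.sym (≡ᵇ⇒≡ (toℕ x) (toℕ y) t))

m≤n⇒m[1+m]²≤4n²m : ∀ {m n} → m ≤ n → m * (suc m * suc m) ≤ 4 * (n * n * m)
m≤n⇒m[1+m]²≤4n²m {zero}        _     = z≤n
m≤n⇒m[1+m]²≤4n²m {suc k} {n} 1+k≤n = begin
  suc k * (suc (suc k) * suc (suc k)) ≤⟨ *-monoʳ-≤ (suc k) (*-mono-≤ 2+k≤n+n 2+k≤n+n) ⟩
  suc k * ((n + n) * (n + n))         ≡⟨ expand (suc k) n ⟩
  4 * (n * n * suc k)                 ∎
  where
  open ≤-Reasoning
  2+k≤n+n : suc (suc k) ≤ n + n
  2+k≤n+n = ≤-trans (s≤s (m≤n+m (suc k) k)) (+-mono-≤ 1+k≤n 1+k≤n)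
  expand : ∀ a b → a * ((b + b) * (b + b)) ≡ 4 * (b * b * a)
  expand = solve-∀

module _ {n} (G : Graph n) where

  deg : Subset n → Fin n → ℕ
  deg S v = ∑[ u ∈ S ] 𝟙 (adj G v u)

  closedDeg : Subset n → Fin n → ℕ
  closedDeg S v = ∑[ u ∈ S ] 𝟙 (eqOrAdj G v u)

  arcs : Subset n → ℕ
  arcs S = ∑² S (λ x y → 𝟙 (adj G x y))

  cliqueArcPair : Fin n → Fin n → Fin n → Fin n → Bool
  cliqueArcPair x y w z = adj G x y ∧ adj G w z ∧ unionClique G x y w z

  cliqueArcPairs : Subset n → ℕ
  cliqueArcPairs S = ∑² S (λ x y → ∑² S (λ w z → 𝟙 (cliqueArcPair x y w z)))

  adj-sym : ∀ {x y} → T (adj G x y) → T (adj G y x)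
  adj-sym {x} {y} = subst T (sym G x y)

  eqOrAdj-sym : ∀ {x y} → T (eqOrAdj G x y) → T (eqOrAdj G y x)
  eqOrAdj-sym {x} {y} t =
    Equivalence.from T-∨ (Sum.map (=v-sym {x = x}) adj-sym (Equivalence.to (T-∨ {x =v y}) t))

  degIn≡deg : ∀ S v → degIn G S v ≡ deg S v
  degIn≡deg S v = trans (count≡∑⊤ (λ u → lookup S u ∧ adj G v u)) (∑⊤-lookup-∧ S (adj G v))

  closedDeg≤1+deg : ∀ S v → closedDeg S v ≤ suc (deg S v)
  closedDeg≤1+deg S v = begin
    closedDeg S v                                   ≤⟨ ∑-mono S (λ u → 𝟙-∨-≤ (v =v u) (adj G v u)) ⟩
    ∑[ u ∈ S ] (𝟙 (v =v u) + 𝟙 (adj G v u))        ≡⟨ ∑-distrib-+ S _ _ ⟩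
    ∑[ u ∈ S ] 𝟙 (v =v u) + deg S v                 ≤⟨ +-monoˡ-≤ (deg S v) (≤-trans (∑-≤-∑⊤ S _) (≤-reflexive (∑⊤-=v v))) ⟩
    suc (deg S v)                                   ∎
    where open ≤-Reasoning

  deg-remove : ∀ {S v} → v ∈ S → deg (S - v) v ≡ deg S v
  deg-remove {S} {v} v∈S = ≡.sym (begin
    deg S v                         ≡⟨ ∑-remove (𝟙 ∘ adj G v) v∈S ⟩
    deg (S - v) v + 𝟙 (adj G v v)  ≡⟨ cong (λ b → deg (S - v) v + 𝟙 b) (irrefl G v) ⟩
    deg (S - v) v + 0               ≡⟨ +-identityʳ _ ⟩
    deg (S - v) v                   ∎)
    where open ≡-Reasoning

  arcs-remove : ∀ {S v} → v ∈ S → arcs S ≡ arcs (S - v) + (deg S v + deg S v)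
  arcs-remove {S} {v} v∈S = trans (∑²-remove (λ x y → 𝟙 (adj G x y)) v∈S)
    (cong (λ k → arcs (S - v) + (k + deg S v))
      (trans (∑-cong (S - v) (λ x → cong 𝟙 (sym G x v))) (deg-remove v∈S)))

  cliqueArcPair-parts : ∀ {x y w z} → T (cliqueArcPair x y w z) →
    T (adj G x y) × T (adj G w z) ×
    T (eqOrAdj G x w) × T (eqOrAdj G x z) × T (eqOrAdj G y w) × T (eqOrAdj G y z)
  cliqueArcPair-parts {x} {y} {w} {z} t =
    let (xy , t₁) = Equivalence.to (T-∧ {adj G x y}) t
        (wz , t₂) = Equivalence.to (T-∧ {adj G w z}) t₁
        (xw , t₃) = Equivalence.to (T-∧ {eqOrAdj G x w}) t₂
        (xz , t₄) = Equivalence.to (T-∧ {eqOrAdj G x z}) t₃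
        (yw , yz) = Equivalence.to (T-∧ {eqOrAdj G y w}) t₄
    in xy , wz , xw , xz , yw , yz

  cliqueArcPairs-remove : ∀ {S v} → v ∈ S →
    cliqueArcPairs S ≤ cliqueArcPairs (S - v) + 4 * (deg S v * (suc (deg S v) * suc (deg S v)))
  cliqueArcPairs-remove {S} {v} v∈S = begin
    cliqueArcPairs S                    ≤⟨ ∑⁴-remove-≤ F v∈S ⟩
    T′ + (∑² S (λ x y → ∑[ w ∈ S ] F x y w v + ∑ S (F x y v)) + Q)
                                        ≡⟨ cong (λ k → T′ + (k + Q)) (∑²-distrib-+ S _ _) ⟩
    T′ + (∑² S (λ x y → ∑[ w ∈ S ] F x y w v) + ∑² S (λ x y → ∑ S (F x y v)) + Q)
                                        ≤⟨ +-monoʳ-≤ T′ (+-mono-≤ (+-mono-≤ at₄ at₃) (+-mono-≤ at₂ at₁)) ⟩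
    T′ + ((X + X) + (X + X))            ≡⟨ cong (T′ +_) (four-copies X) ⟩
    T′ + 4 * X                          ∎
    where
    open ≤-Reasoning
    four-copies : ∀ a → (a + a) + (a + a) ≡ 4 * a
    four-copies = solve-∀
    rotate : ∀ a b → a * (a * b) ≡ b * (a * a)
    rotate = solve-∀
    F : Fin n → Fin n → Fin n → Fin n → ℕ
    F x y w z = 𝟙 (cliqueArcPair x y w z)
    T′ = cliqueArcPairs (S - v)
    Q = ∑[ x ∈ S ] ∑² S (F x v) + ∑[ y ∈ S ] ∑² S (F v y)
    δ = deg S v
    X = δ * (suc δ * suc δ)
    N B : Fin n → ℕ
    N u = 𝟙 (adj G v u)
    B u = 𝟙 (eqOrAdj G v u)
    c≤ : closedDeg S v ≤ suc δ
    c≤ = closedDeg≤1+deg S v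
    NBB≤X : deg S v * (closedDeg S v * closedDeg S v) ≤ X
    NBB≤X = *-monoʳ-≤ δ (*-mono-≤ c≤ c≤)
    BBN≤X : closedDeg S v * (closedDeg S v * deg S v) ≤ X
    BBN≤X = ≤-trans (*-mono-≤ c≤ (*-monoˡ-≤ δ c≤)) (≤-reflexive (rotate (suc δ) δ))
    at₁ : ∑[ y ∈ S ] ∑² S (F v y) ≤ X
    at₁ = ≤-trans (∑³-≤-product S N B B λ y w z → 𝟙-≤-* _ _ _ λ t →
      let (xy , _ , xw , xz , _) = cliqueArcPair-parts t in xy , xw , xz) NBB≤X
    at₂ : ∑[ x ∈ S ] ∑² S (F x v) ≤ X
    at₂ = ≤-trans (∑³-≤-product S N B B λ x w z → 𝟙-≤-* _ _ _ λ t →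
      let (xy , _ , _ , _ , yw , yz) = cliqueArcPair-parts t in adj-sym xy , yw , yz) NBB≤X
    at₃ : ∑² S (λ x y → ∑ S (F x y v)) ≤ X
    at₃ = ≤-trans (∑³-≤-product S B B N λ x y z → 𝟙-≤-* _ _ _ λ t →
      let (_ , wz , xw , _ , yw , _) = cliqueArcPair-parts t in eqOrAdj-sym xw , eqOrAdj-sym yw , wz) BBN≤X
    at₄ : ∑² S (λ x y → ∑[ w ∈ S ] F x y w v) ≤ X
    at₄ = ≤-trans (∑³-≤-product S B B N λ x y w → 𝟙-≤-* _ _ _ λ t →
      let (_ , wz , _ , xz , _ , yz) = cliqueArcPair-parts t in eqOrAdj-sym xz , eqOrAdj-sym yz , adj-sym wz) BBN≤X

  degeneracy-induction : ∀ {d} → DegenerateBy G d → (P : Subset n → Set) → P ∅ →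
    (∀ S v → v ∈ S → deg S v ≤ d → P (S - v) → P S) → ∀ S → P S
  degeneracy-induction {d} degenerate P base step S = go S (On.wellFounded size <-wellFounded S)
    where
    go : ∀ S → Acc (_<_ on size) S → P S
    go S (acc rec) with nonempty? S
    ... | no  S-empty = subst P (≡.sym (Empty-unique S-empty)) base
    ... | yes S-nonempty with degenerate S S-nonempty
    ...   | v , v∈S , degIn≤d = step S v v∈S (subst (_≤ d) (degIn≡deg S v) degIn≤d)
                                  (go (S - v) (rec (≤-reflexive (≡.sym (size-remove v∈S)))))

  arcs-bound : ∀ {d} → DegenerateBy G d → ∀ S → arcs S ≤ 2 * (d * size S)
  arcs-bound {d} degenerate = degeneracy-induction degenerate (λ S → arcs S ≤ 2 * (d * size S))
    (≤-trans (≤-reflexive (∑-∅ {n} _)) z≤n) step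
    where
    step : ∀ S v → v ∈ S → deg S v ≤ d → arcs (S - v) ≤ 2 * (d * size (S - v)) → arcs S ≤ 2 * (d * size S)
    step S v v∈S δ≤d ih = begin
      arcs S                                   ≡⟨ arcs-remove v∈S ⟩
      arcs (S - v) + (deg S v + deg S v)       ≤⟨ +-mono-≤ ih (+-mono-≤ δ≤d δ≤d) ⟩
      2 * (d * size (S - v)) + (d + d)         ≡⟨ add-vertex d (size (S - v)) ⟩
      2 * (d * suc (size (S - v)))             ≡⟨ cong (λ s → 2 * (d * s)) (≡.sym (size-remove v∈S)) ⟩
      2 * (d * size S)                         ∎
      where
      open ≤-Reasoning
      add-vertex : ∀ d s → 2 * (d * s) + (d + d) ≡ 2 * (d * suc s)
      add-vertex = solve-∀

  cliqueArcPairs-bound : ∀ {d} → DegenerateBy G d → ∀ S → cliqueArcPairs S ≤ 8 * (d * d * arcs S)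
  cliqueArcPairs-bound {d} degenerate = degeneracy-induction degenerate (λ S → cliqueArcPairs S ≤ 8 * (d * d * arcs S))
    (≤-trans (≤-reflexive (∑-∅ {n} _)) z≤n) step
    where
    step : ∀ S v → v ∈ S → deg S v ≤ d → cliqueArcPairs (S - v) ≤ 8 * (d * d * arcs (S - v)) →
           cliqueArcPairs S ≤ 8 * (d * d * arcs S)
    step S v v∈S δ≤d ih = begin
      cliqueArcPairs S                                          ≤⟨ cliqueArcPairs-remove v∈S ⟩
      cliqueArcPairs (S - v) + 4 * (δ * (suc δ * suc δ))        ≤⟨ +-mono-≤ ih (*-monoʳ-≤ 4 (m≤n⇒m[1+m]²≤4n²m δ≤d)) ⟩
      8 * (d * d * arcs (S - v)) + 4 * (4 * (d * d * δ))        ≡⟨ regroup d (arcs (S - v)) δ ⟩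
      8 * (d * d * (arcs (S - v) + (δ + δ)))                    ≡⟨ cong (λ e → 8 * (d * d * e)) (≡.sym (arcs-remove v∈S)) ⟩
      8 * (d * d * arcs S)                                      ∎
      where
      open ≤-Reasoning
      δ = deg S v
      regroup : ∀ d e δ → 8 * (d * d * e) + 4 * (4 * (d * d * δ)) ≡ 8 * (d * d * (e + (δ + δ)))
      regroup = solve-∀

  numEdges≡∑²isEdge : numEdges G ≡ ∑² ⊤ (λ x y → 𝟙 (isEdge G x y))
  numEdges≡∑²isEdge = trans (sum-map-allFin {n} _) (∑-cong (⊤ {n}) (λ x → count≡∑⊤ (isEdge G x)))

  adj-split : ∀ x y → 𝟙 (adj G x y) ≡ 𝟙 (isEdge G x y) + 𝟙 (isEdge G y x)
  adj-split x y with <-cmp (toℕ x) (toℕ y)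
  ... | tri< x<y _ y≮x rewrite <v-true x<y | <v-false y≮x = ≡.sym (+-identityʳ _)
  ... | tri> x≮y _ y<x rewrite <v-false x≮y | <v-true y<x = cong 𝟙 (sym G x y)
  ... | tri≈ _ x≡y _ rewrite toℕ-injective x≡y | <v-false (<-irrefl {toℕ y} refl) | irrefl G y = refl

  arcs-⊤ : arcs ⊤ ≡ 2 * numEdges G
  arcs-⊤ = begin
    arcs ⊤                                                   ≡⟨ ∑-cong (⊤ {n}) (λ x → ∑-cong (⊤ {n}) (adj-split x)) ⟩
    ∑² ⊤ (λ x y → 𝟙 (isEdge G x y) + 𝟙 (isEdge G y x))      ≡⟨ ∑²-distrib-+ (⊤ {n}) _ _ ⟩
    ∑² ⊤ (λ x y → 𝟙 (isEdge G x y)) + ∑² ⊤ (λ x y → 𝟙 (isEdge G y x))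
                                                             ≡⟨ cong (∑² ⊤ (λ x y → 𝟙 (isEdge G x y)) +_) (∑-comm (⊤ {n}) (⊤ {n}) _) ⟩
    ∑² ⊤ (λ x y → 𝟙 (isEdge G x y)) + ∑² ⊤ (λ x y → 𝟙 (isEdge G x y))
                                                             ≡⟨ cong₂ _+_ (≡.sym numEdges≡∑²isEdge) (≡.sym numEdges≡∑²isEdge) ⟩
    numEdges G + numEdges G                                  ≡⟨ cong (numEdges G +_) (≡.sym (+-identityʳ _)) ⟩
    2 * numEdges G                                           ∎
    where open ≡-Reasoning

  numVCCEdges≤cliqueArcPairs : numVCCEdges G ≤ cliqueArcPairs ⊤
  numVCCEdges≤cliqueArcPairs = ≤-trans (≤-reflexive numVCCEdges≡∑⁴) (∑²-mono ⊤ λ x y → ∑²-mono ⊤ λ w z → 𝟙-mono (vccEdge⇒cliqueArcPair x y w z))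
    where
    numVCCEdges≡∑⁴ : numVCCEdges G ≡ ∑² ⊤ (λ x y → ∑² ⊤ (λ w z →
                  𝟙 (isEdge G x y ∧ isEdge G w z ∧ lexLt x y w z ∧ unionClique G x y w z)))
    numVCCEdges≡∑⁴ = trans (sum-map-allFin {n} _) (∑-cong (⊤ {n}) λ x → trans (sum-map-allFin {n} _) (∑-cong (⊤ {n}) λ y →
              trans (sum-map-allFin {n} _) (∑-cong (⊤ {n}) λ w → count≡∑⊤ {n} _)))
    vccEdge⇒cliqueArcPair : ∀ x y w z → T (isEdge G x y ∧ isEdge G w z ∧ lexLt x y w z ∧ unionClique G x y w z) →
             T (cliqueArcPair x y w z)
    vccEdge⇒cliqueArcPair x y w z t =
      let (xy , t₁) = Equivalence.to (T-∧ {isEdge G x y}) t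
          (wz , t₂) = Equivalence.to (T-∧ {isEdge G w z}) t₁
          (_ , clique) = Equivalence.to (T-∧ {lexLt x y w z}) t₂
      in Equivalence.from T-∧ (proj₂ (Equivalence.to (T-∧ {x <v y}) xy) ,
           Equivalence.from T-∧ (proj₂ (Equivalence.to (T-∧ {w <v z}) wz) , clique))


  numEdges≤d*n : ∀ {d} → DegenerateBy G d → numEdges G ≤ d * n
  numEdges≤d*n {d} degenerate = *-cancelˡ-≤ 2 (begin
    2 * numEdges G         ≡⟨ ≡.sym arcs-⊤ ⟩
    arcs ⊤                 ≤⟨ arcs-bound degenerate ⊤ ⟩
    2 * (d * size (⊤ {n})) ≡⟨ cong (λ k → 2 * (d * k)) (size-⊤ n) ⟩
    2 * (d * n)            ∎)
    where open ≤-Reasoning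

  numVCCEdges≤16*d*d*m : ∀ {d} → DegenerateBy G d → numVCCEdges G ≤ 16 * (d * d * numEdges G)
  numVCCEdges≤16*d*d*m {d} degenerate = begin
    numVCCEdges G                  ≤⟨ numVCCEdges≤cliqueArcPairs ⟩
    cliqueArcPairs ⊤               ≤⟨ cliqueArcPairs-bound degenerate ⊤ ⟩
    8 * (d * d * arcs ⊤)           ≡⟨ cong (λ e → 8 * (d * d * e)) arcs-⊤ ⟩
    8 * (d * d * (2 * numEdges G)) ≡⟨ regroup d (numEdges G) ⟩
    16 * (d * d * numEdges G)      ∎
    where
    open ≤-Reasoning
    regroup : ∀ d m → 8 * (d * d * (2 * m)) ≡ 16 * (d * d * m)
    regroup = solve-∀

theorem2 : ∃ λ (C : ℕ) → ∀ (n : ℕ) (G : Graph n) (d : ℕ) → IsDegeneracy G d →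
    (numVCCVertices G ≡ numEdges G) × (numEdges G ≤ d * n) × (numVCCEdges G ≤ C * (d * d * numEdges G))
theorem2 = 16 , λ n G d (degenerate , _) →
  refl , numEdges≤d*n G degenerate , numVCCEdges≤16*d*d*m G degenerate
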